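{- Let $n \in \mathbb{N}$ be odd and of the form $n = a^2 + 1$ with $a \in \mathbb{N}$. Let $C_n$ be a cyclic group of order $n$ and $H = \mathcal{B}_{\pm}(C_n)$. Then $a - 1 \in \Delta^{\ast}(H)$.
   Context: For a subset $G_0$ of an abelian group $G$, a sequence over $G_0$ is a finite unordered list $S = g_1\cdots g_\ell$ of elements of $G_0$ (repetitions allowed), forming the free commutative monoid over $G_0$ under concatenation. $S$ is a plus-minus weighted zero-sum sequence if $\sum_i \epsilon_i g_i = 0$ for some $\epsilon_i\in\{+1,-1\}$; $\mathcal{B}_{\pm}(G_0)$ is the monoid of these. For a monoid $H$ with trivial unit group: an atom is a non-identity element not a product of two non-identity elements; $\mathsf{L}_H(a)$ is the set of $k$ such that $a$ is a product of $k$ atoms; for finite $L=\{a_0<\dots<a_k\}$, $\Delta(L)=\{a_i-a_{i-1}\}$; $\Delta(H)=\bigcup_a\Delta(\mathsf{L}_H(a))$; a submonoid $S$ is divisor-closed if every divisor in $H$ of an element of $S$ lies in $S$; $\Delta^{\ast}(H)=\{\min\Delta(S)\colon S \text{ divisor-closed submonoid},\ \Delta(S)\ne\emptyset\}$. -}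

module Defs where

open import Level using (Level)
open import Data.Nat using (ℕ; zero; suc; _<_; _≤_)
open import Data.Nat.Base using (_+_)
open import Data.Fin using (Fin; toℕ)
open import Data.Integer using (ℤ; +_; -_) renaming (_+_ to _+ℤ_)
open import Data.Integer.Divisibility using (_∣_)
open import Data.List using (List; []; _∷_; _++_; length; concat)
open import Data.List.Relation.Unary.All using (All)
open import Data.List.Relation.Binary.Permutation.Propositional using (_↭_)
open import Data.Product using (Σ; _×_; ∃-syntax)
open import Data.Sum using (_⊎_)
open import Relation.Binary.PropositionalEquality using (_≡_)
open import Relation.Nullary using (¬_)

-- The cyclic group C_n is modelled as ℤ/nℤ with elements Fin n
-- (representatives 0 … n-1); g ∈ C_n is zero iff n divides its representative.
-- A sequence over C_n is a list; two sequences are equal iff they are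
-- permutations of each other (_↭_), so sequences form the free commutative
-- monoid with concatenation _++_.
Seq : ℕ → Set
Seq n = List (Fin n)

data SignedSum {n : ℕ} : Seq n → ℤ → Set where
  ss-nil   : SignedSum [] (+ 0)
  ss-plus  : ∀ {s z} (g : Fin n) → SignedSum s z → SignedSum (g ∷ s) ((+ toℕ g) +ℤ z)
  ss-minus : ∀ {s z} (g : Fin n) → SignedSum s z → SignedSum (g ∷ s) ((- (+ toℕ g)) +ℤ z)

Bpm : (n : ℕ) → Seq n → Set
Bpm n s = ∃[ z ] (SignedSum s z × (+ n) ∣ z)

record IsDivClosedSubmonoid (n : ℕ) (P : Seq n → Set) : Set where
  field
    subset    : ∀ s → P s → Bpm n s
    has-unit  : P []
    closed    : ∀ s t → P s → P t → P (s ++ t)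
    divClosed : ∀ s t u → P s → Bpm n t → Bpm n u → (t ++ u) ↭ s → P t

IsAtom : {n : ℕ} → (Seq n → Set) → Seq n → Set
IsAtom P x =
  P x × ¬ (x ↭ []) ×
  (∀ y z → P y → P z → x ↭ (y ++ z) → (y ↭ []) ⊎ (z ↭ []))

InLengths : {n : ℕ} → (Seq n → Set) → Seq n → ℕ → Set
InLengths P x k =
  ∃[ as ] (length as ≡ k × All (IsAtom P) as × concat as ↭ x)

InDeltaL : {n : ℕ} → (Seq n → Set) → Seq n → ℕ → Set
InDeltaL P x d =
  0 < d × ∃[ k ] (InLengths P x k × InLengths P x (k + d) ×
    (∀ m → k < m → m < k + d → ¬ InLengths P x m))

InDelta : {n : ℕ} → (Seq n → Set) → ℕ → Set
InDelta P d = ∃[ x ] (P x × InDeltaL P x d)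

InDeltaStar : (n : ℕ) → ℕ → Set₁
InDeltaStar n d =
  Σ (Seq n → Set) λ P →
    IsDivClosedSubmonoid n P × InDelta P d × (∀ e → InDelta P e → d ≤ e)

-- With d = a - 1, work in the divisor-closed submonoid B±({g, y}) of B±(C_n) for g = 1 and y = a.
-- Its elements are the monomials g^i y^j admitting a zero-sum choice of signs. As a² ≡ -1 (mod n),
-- such a sign choice either contains a cancelling pair on g or on y, or has n ∣ i + a j (equal signs)
-- or n ∣ j + a i (opposite signs; multiplication by a swaps the two). Splitting off g², y², g^n, y^n,
-- g y^a or g^(n - a j) y^j shows that every atom has length 2 + c d, using n = 2 + (a + 1) d.
-- Hence an element with a factorisation of length k has length 2k + C d, and since d is odd (n is odd)
-- any two factorisation lengths differ by a multiple of d, so min Δ ≥ d. Finally (g^a y)² = y² (g²)^a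
-- has factorisation lengths 2 and a + 1 = 2 + d.
module Submission where

open import Defs
open import Data.Nat
  using (ℕ; zero; suc; _+_; _*_; _∸_; _%_; _<_; _≤_; s≤s; z≤n; _≤?_; _≟_; >-nonZero)
open import Data.Nat.Properties
open import Data.Nat.ListAction using (sum)
open import Data.Nat.ListAction.Properties using (sum-++; sum-↭)
import Data.Nat.Divisibility as ℕ
open import Data.Nat.DivMod using (m*n%n≡0)
open import Data.Integer using (ℤ; +_; -_)
import Data.Integer as ℤ
import Data.Integer.Properties as ℤₚ
import Data.Integer.Divisibility as ℤᵤ
open import Data.Integer.Divisibility.Signed
  using (_∣_; ∣ᵤ⇒∣; ∣⇒∣ᵤ; ∣m∣n⇒∣m+n; ∣m⇒∣-m; ∣n⇒∣m*n; ∣m⇒∣m*n; ∣-refl)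
import Data.Integer.Tactic.RingSolver as ℤ-Solver
import Data.Nat.Tactic.RingSolver as ℕ-Solver
open import Data.Fin using (Fin; toℕ; fromℕ<)
open import Data.Fin.Properties using (toℕ-fromℕ<)
open import Data.List using (List; []; _∷_; _++_; length; concat; replicate; map)
open import Data.List.Properties using (length-++; length-replicate; map-++; ++-identityʳ)
open import Data.List.Relation.Unary.All using (All; []; _∷_)
import Data.List.Relation.Unary.All.Properties as All
open import Data.List.Relation.Binary.Permutation.Propositional
  using (_↭_; ↭-refl; ↭-sym; ↭-trans; prep; module PermutationReasoning)
import Data.List.Relation.Binary.Permutation.Propositional.Properties as ↭
open import Data.Product using (_×_; _,_; proj₂; ∃-syntax)
open import Data.Sum using (_⊎_; inj₁; inj₂) renaming (map to ⊎-map)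
open import Data.Empty using (⊥-elim)
open import Function using (id; _∘′_)
open import Relation.Nullary using (¬_; yes; no)
open import Relation.Binary.PropositionalEquality

replicate-+ : ∀ {A : Set} (x : A) m n → replicate (m + n) x ≡ replicate m x ++ replicate n x
replicate-+ x zero    n = refl
replicate-+ x (suc m) n = cong (x ∷_) (replicate-+ x m n)

length≡0⇒↭[] : ∀ {A : Set} (s : List A) → length s ≡ 0 → s ↭ []
length≡0⇒↭[] [] _ = ↭-refl

counts-injective : ∀ {u v} → u < v → ∀ {i j i′ j′} →
  i + j ≡ i′ + j′ → i * u + j * v ≡ i′ * u + j′ * v → i ≡ i′ × j ≡ j′
counts-injective {u} u<v {i} {j} {i′} {j′} len≡ weight≡ with m≤n⇒∃[o]m+o≡n u<v
... | w , refl = i≡i′ , j≡j′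
  where
  separate : ∀ u w i j → i * u + j * (suc u + w) ≡ (i + j) * u + j * suc w
  separate = ℕ-Solver.solve-∀
  j≡j′ : j ≡ j′
  j≡j′ = *-cancelʳ-≡ j j′ (suc w) (+-cancelˡ-≡ ((i + j) * u) (j * suc w) (j′ * suc w) (begin
    (i + j) * u + j * suc w      ≡⟨ sym (separate u w i j) ⟩
    i * u + j * (suc u + w)      ≡⟨ weight≡ ⟩
    i′ * u + j′ * (suc u + w)    ≡⟨ separate u w i′ j′ ⟩
    (i′ + j′) * u + j′ * suc w   ≡⟨ cong (λ m → m * u + j′ * suc w) (sym len≡) ⟩
    (i + j) * u + j′ * suc w     ∎))
    where open ≡-Reasoning
  i≡i′ : i ≡ i′
  i≡i′ = +-cancelʳ-≡ j i i′ (trans len≡ (cong (λ m → i′ + m) (sym j≡j′)))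

signed-∣ : ∀ {n} z → + n ℤᵤ.∣ z → + n ∣ z
signed-∣ {n} z = ∣ᵤ⇒∣ {k = + n} {i = z}

unsigned-∣ : ∀ {n} z → + n ∣ z → + n ℤᵤ.∣ z
unsigned-∣ {n} z = ∣⇒∣ᵤ {k = + n} {i = z}

module _ {n : ℕ} where

  SignedSum-++ : ∀ {s t : Seq n} {z w} → SignedSum s z → SignedSum t w → SignedSum (s ++ t) (z ℤ.+ w)
  SignedSum-++ {w = w} ss-nil st = subst (SignedSum _) (sym (ℤₚ.+-identityˡ w)) st
  SignedSum-++ {w = w} (ss-plus {z = z} x ss) st =
    subst (SignedSum _) (sym (ℤₚ.+-assoc (+ toℕ x) z w)) (ss-plus x (SignedSum-++ ss st))
  SignedSum-++ {w = w} (ss-minus {z = z} x ss) st =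
    subst (SignedSum _) (sym (ℤₚ.+-assoc (- + toℕ x) z w)) (ss-minus x (SignedSum-++ ss st))

  SignedSum-replicate⁺ : ∀ p (x : Fin n) → SignedSum (replicate p x) (+ (p * toℕ x))
  SignedSum-replicate⁺ zero    x = ss-nil
  SignedSum-replicate⁺ (suc p) x = ss-plus x (SignedSum-replicate⁺ p x)

  SignedSum-replicate⁻ : ∀ p (x : Fin n) → SignedSum (replicate p x) (- + (p * toℕ x))
  SignedSum-replicate⁻ zero    x = ss-nil
  SignedSum-replicate⁻ (suc p) x =
    subst (SignedSum _) (sym (ℤₚ.neg-distrib-+ (+ toℕ x) (+ (p * toℕ x))))
      (ss-minus x (SignedSum-replicate⁻ p x))

  weight : Seq n → ℕ
  weight s = sum (map toℕ s)

  weight-↭ : ∀ {s t} → s ↭ t → weight s ≡ weight t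
  weight-↭ s↭t = sum-↭ (↭.map⁺ toℕ s↭t)

  weight-++ : ∀ s t → weight (s ++ t) ≡ weight s + weight t
  weight-++ s t = trans (cong sum (map-++ toℕ s t)) (sum-++ (map toℕ s) (map toℕ t))

  weight-replicate : ∀ i x → weight (replicate i x) ≡ i * toℕ x
  weight-replicate zero    x = refl
  weight-replicate (suc i) x = cong (λ m → toℕ x + m) (weight-replicate i x)

  Bpm-[] : Bpm n []
  Bpm-[] = + 0 , ss-nil , ℕ._∣0 n

  Bpm-++ : ∀ {s t} → Bpm n s → Bpm n t → Bpm n (s ++ t)
  Bpm-++ (z , ss , n∣z) (w , st , n∣w) =
    z ℤ.+ w , SignedSum-++ ss st , unsigned-∣ (z ℤ.+ w) (∣m∣n⇒∣m+n (signed-∣ z n∣z) (signed-∣ w n∣w))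

  BpmOver : (Fin n → Set) → Seq n → Set
  BpmOver G₀ s = All G₀ s × Bpm n s

  BpmOver-isDivClosedSubmonoid : ∀ G₀ → IsDivClosedSubmonoid n (BpmOver G₀)
  BpmOver-isDivClosedSubmonoid G₀ = record
    { subset    = λ _ → proj₂
    ; has-unit  = [] , Bpm-[]
    ; closed    = λ s t (G₀s , s∈B) (G₀t , t∈B) → All.++⁺ G₀s G₀t , Bpm-++ s∈B t∈B
    ; divClosed = λ s t u (G₀s , _) t∈B _ t++u↭s →
        All.++⁻ˡ t (↭.All-resp-↭ (↭-sym t++u↭s) G₀s) , t∈B
    }

  concat-atoms : ∀ {P} → IsDivClosedSubmonoid n P → ∀ {as} → All (IsAtom P) as → P (concat as)
  concat-atoms P-sub []                        = IsDivClosedSubmonoid.has-unit P-sub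
  concat-atoms P-sub {x ∷ as} ((x∈P , _) ∷ atoms) =
    IsDivClosedSubmonoid.closed P-sub x (concat as) x∈P (concat-atoms P-sub atoms)

Odd : ℕ → Set
Odd d = ∀ e → d ≢ e + e

TwoPlusMultipleOf : ℕ → ℕ → Set
TwoPlusMultipleOf d m = ∃[ c ] m ≡ 2 + c * d

odd-multiple≡double⇒≤ : ∀ {d} → Odd d → ∀ c e → suc c * d ≡ e + e → d ≤ e
odd-multiple≡double⇒≤ {d} d-odd zero    e d+0≡e+e = ⊥-elim (d-odd e (trans (sym (+-identityʳ d)) d+0≡e+e))
odd-multiple≡double⇒≤ {d} d-odd (suc c) e eq with d ≤? e
... | yes d≤e = d≤e
... | no  d≰e = ⊥-elim (<⇒≱ (+-mono-< e<d e<d) (subst (d + d ≤_) eq (+-monoʳ-≤ d (m≤m+n d (c * d)))))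
  where
  e<d : e < d
  e<d = ≰⇒> d≰e

odd-multiples-differ-by-double⇒≤ : ∀ {d} → Odd d →
  ∀ C₁ C₂ e → 0 < e → C₁ * d ≡ (e + e) + C₂ * d → d ≤ e
odd-multiples-differ-by-double⇒≤ {d} d-odd C₁ C₂ e 0<e eq with C₁ ≤? C₂
... | yes C₁≤C₂ = ⊥-elim (<⇒≱ C₂d<C₁d (*-monoˡ-≤ d C₁≤C₂))
  where
  C₂d<C₁d : C₂ * d < C₁ * d
  C₂d<C₁d = subst (C₂ * d <_) (sym eq) (m<n+m (C₂ * d) (≤-trans 0<e (m≤m+n e e)))
... | no  C₁≰C₂ with m≤n⇒∃[o]m+o≡n (≰⇒> C₁≰C₂)
...   | c , refl = odd-multiple≡double⇒≤ d-odd c e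
        (+-cancelʳ-≡ (C₂ * d) (suc c * d) (e + e) (trans (sym (expand C₂ c d)) eq))
  where
  expand : ∀ C₂ c d → (suc C₂ + c) * d ≡ suc c * d + C₂ * d
  expand = ℕ-Solver.solve-∀

module AtomLengths {n : ℕ} (P : Seq n → Set) (d : ℕ)
  (atom-length : ∀ x → IsAtom P x → TwoPlusMultipleOf d (length x)) where

  length-concat-atoms : ∀ {as} → All (IsAtom P) as →
    ∃[ C ] length (concat as) ≡ length as + length as + C * d
  length-concat-atoms []                         = 0 , refl
  length-concat-atoms {x ∷ as} (x-atom ∷ atoms) with atom-length x x-atom | length-concat-atoms atoms
  ... | c , |x|≡ | C , |xs|≡ = c + C , (begin
    length (x ++ concat as)                         ≡⟨ length-++ x ⟩
    length x + length (concat as)                   ≡⟨ cong₂ _+_ |x|≡ |xs|≡ ⟩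
    (2 + c * d) + (length as + length as + C * d)   ≡⟨ regroup c C (length as) d ⟩
    suc (length as) + suc (length as) + (c + C) * d ∎)
    where
    open ≡-Reasoning
    regroup : ∀ c C L d → (2 + c * d) + (L + L + C * d) ≡ suc L + suc L + (c + C) * d
    regroup = ℕ-Solver.solve-∀

  length-factorization : ∀ {x k} → InLengths P x k → ∃[ C ] length x ≡ k + k + C * d
  length-factorization {x} {k} (as , |as|≡k , atoms , concat↭x) with length-concat-atoms atoms
  ... | C , eq = C , trans (sym (↭.↭-length concat↭x)) (trans eq (cong (λ m → m + m + C * d) |as|≡k))

  lengths-gap : Odd d → ∀ {x k e} → InLengths P x k → InLengths P x (k + e) → 0 < e → d ≤ e
  lengths-gap d-odd {x} {k} {e} Lk Lk+e 0<e
    with length-factorization Lk | length-factorization Lk+e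
  ... | C₁ , |x|≡₁ | C₂ , |x|≡₂ = odd-multiples-differ-by-double⇒≤ d-odd C₁ C₂ e 0<e
    (+-cancelˡ-≡ (k + k) (C₁ * d) (e + e + C₂ * d) (trans (sym |x|≡₁) (trans |x|≡₂ (regroup k e C₂ d))))
    where
    regroup : ∀ k e C₂ d → k + e + (k + e) + C₂ * d ≡ k + k + (e + e + C₂ * d)
    regroup = ℕ-Solver.solve-∀

  Δ-lower-bound : Odd d → ∀ {e} → InDelta P e → d ≤ e
  Δ-lower-bound d-odd (_ , _ , 0<e , _ , Lk , Lk+e , _) = lengths-gap d-odd Lk Lk+e 0<e

  lengths-differing-by-d⇒Δ : Odd d → ∀ {x k} →
    InLengths P x k → InLengths P x (k + d) → InDeltaL P x d
  lengths-differing-by-d⇒Δ d-odd {x} {k} Lk Lk+d = 0<d , k , Lk , Lk+d , no-length-between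
    where
    0<d : 0 < d
    0<d = n≢0⇒n>0 (d-odd 0)
    no-length-between : ∀ m → k < m → m < k + d → ¬ InLengths P x m
    no-length-between m k<m m<k+d Lm with m≤n⇒∃[o]m+o≡n k<m
    ... | e , refl = <⇒≱ (+-cancelˡ-< k (suc e) d (subst (_< k + d) (sym (+-suc k e)) m<k+d))
                           (lengths-gap d-odd Lk (subst (InLengths P x) (sym (+-suc k e)) Lm) (s≤s z≤n))

Splits : (ℕ → ℕ → Set) → ℕ → ℕ → Set
Splits Q i j = ∃[ i₁ ] ∃[ j₁ ] ∃[ i₂ ] ∃[ j₂ ]
  (i₁ + i₂ ≡ i × j₁ + j₂ ≡ j × Q i₁ j₁ × Q i₂ j₂ × 0 < i₁ + j₁ × 0 < i₂ + j₂)

Splits-map : ∀ {Q Q′ : ℕ → ℕ → Set} → (∀ {i j} → Q i j → Q′ i j) → ∀ {i j} → Splits Q i j → Splits Q′ i j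
Splits-map f (i₁ , j₁ , i₂ , j₂ , i≡ , j≡ , q₁ , q₂ , p₁ , p₂) = i₁ , j₁ , i₂ , j₂ , i≡ , j≡ , f q₁ , f q₂ , p₁ , p₂

Splits-flip : ∀ {Q Q′ : ℕ → ℕ → Set} → (∀ {i j} → Q j i → Q′ i j) → ∀ {i j} → Splits Q j i → Splits Q′ i j
Splits-flip f (j₁ , i₁ , j₂ , i₂ , j≡ , i≡ , q₁ , q₂ , p₁ , p₂) =
  i₁ , j₁ , i₂ , j₂ , i≡ , j≡ , f q₁ , f q₂ , subst (0 <_) (+-comm j₁ i₁) p₁ , subst (0 <_) (+-comm j₂ i₂) p₂

split-or-whole : ∀ {Q : ℕ → ℕ → Set} {d i j i₁ j₁ i₂ j₂} → Q i₁ j₁ → Q i₂ j₂ →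
  i₁ + i₂ ≡ i → j₁ + j₂ ≡ j → 0 < i₁ + j₁ → TwoPlusMultipleOf d (i₁ + j₁) →
  TwoPlusMultipleOf d (i + j) ⊎ Splits Q i j
split-or-whole {i₁ = i₁} {j₁} {zero} {zero} _ _ refl refl _ (c , eq) =
  inj₁ (c , trans (cong₂ _+_ (+-identityʳ i₁) (+-identityʳ j₁)) eq)
split-or-whole {i₂ = zero}  {suc j₂} q₁ q₂ i≡ j≡ p₁ _ = inj₂ (_ , _ , _ , _ , i≡ , j≡ , q₁ , q₂ , p₁ , s≤s z≤n)
split-or-whole {i₂ = suc i₂}         q₁ q₂ i≡ j≡ p₁ _ = inj₂ (_ , _ , _ , _ , i≡ , j≡ , q₁ , q₂ , p₁ , s≤s z≤n)

module TwoLetters {n : ℕ} (g y : Fin n) where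

  Letter : Fin n → Set
  Letter x = x ≡ g ⊎ x ≡ y

  B± : Seq n → Set
  B± = BpmOver Letter

  monomial : ℕ → ℕ → Seq n
  monomial i j = replicate i g ++ replicate j y

  length-monomial : ∀ i j → length (monomial i j) ≡ i + j
  length-monomial i j = trans (length-++ (replicate i g)) (cong₂ _+_ (length-replicate i) (length-replicate j))

  weight-monomial : ∀ i j → weight (monomial i j) ≡ i * toℕ g + j * toℕ y
  weight-monomial i j =
    trans (weight-++ (replicate i g) _) (cong₂ _+_ (weight-replicate i g) (weight-replicate j y))

  monomial↭[]⇒empty : ∀ i j → monomial i j ↭ [] → i + j ≡ 0
  monomial↭[]⇒empty i j m↭[] = trans (sym (length-monomial i j)) (↭.↭-length m↭[])

  ↭monomial-empty : ∀ {s} i j → s ↭ monomial i j → i + j ≡ 0 → s ↭ []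
  ↭monomial-empty {s} i j s↭m i+j≡0 =
    length≡0⇒↭[] s (trans (↭.↭-length s↭m) (trans (length-monomial i j) i+j≡0))

  monomial-+ : ∀ i₁ i₂ j₁ j₂ → monomial (i₁ + i₂) (j₁ + j₂) ↭ monomial i₁ j₁ ++ monomial i₂ j₂
  monomial-+ i₁ i₂ j₁ j₂ = begin
    monomial (i₁ + i₂) (j₁ + j₂)                   ≡⟨ cong₂ _++_ (replicate-+ g i₁ i₂) (replicate-+ y j₁ j₂) ⟩
    (gs₁ ++ gs₂) ++ (ys₁ ++ ys₂)                   ↭⟨ ↭.++-assoc gs₁ gs₂ _ ⟩
    gs₁ ++ (gs₂ ++ ys₁ ++ ys₂)                     ↭⟨ ↭.++⁺ˡ gs₁ (↭.shifts gs₂ ys₁) ⟩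
    gs₁ ++ (ys₁ ++ gs₂ ++ ys₂)                     ↭⟨ ↭.++-assoc gs₁ ys₁ _ ⟨
    monomial i₁ j₁ ++ monomial i₂ j₂              ∎
    where
    open PermutationReasoning
    gs₁ gs₂ ys₁ ys₂ : Seq n
    gs₁ = replicate i₁ g
    gs₂ = replicate i₂ g
    ys₁ = replicate j₁ y
    ys₂ = replicate j₂ y

  y∷monomial : ∀ i j → y ∷ monomial i j ↭ monomial i (suc j)
  y∷monomial i j = ↭-sym (↭.shift y (replicate i g) (replicate j y))

  monomial-injective : toℕ g < toℕ y → ∀ {i j i′ j′} → monomial i j ↭ monomial i′ j′ → i ≡ i′ × j ≡ j′
  monomial-injective g<y {i} {j} {i′} {j′} m↭m′ = counts-injective g<y
    (trans (sym (length-monomial i j)) (trans (↭.↭-length m↭m′) (length-monomial i′ j′)))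
    (trans (sym (weight-monomial i j)) (trans (weight-↭ m↭m′) (weight-monomial i′ j′)))

  signedValue : ℕ → ℕ → ℕ → ℕ → ℤ
  signedValue p₁ q₁ p₂ q₂ =
    (+ (p₁ * toℕ g) ℤ.- + (q₁ * toℕ g)) ℤ.+ (+ (p₂ * toℕ y) ℤ.- + (q₂ * toℕ y))

  SignedSum-monomial : ∀ p₁ q₁ p₂ q₂ →
    SignedSum (monomial (p₁ + q₁) (p₂ + q₂)) (signedValue p₁ q₁ p₂ q₂)
  SignedSum-monomial p₁ q₁ p₂ q₂ =
    subst (λ s → SignedSum s (signedValue p₁ q₁ p₂ q₂))
      (sym (cong₂ _++_ (replicate-+ g p₁ q₁) (replicate-+ y p₂ q₂)))
      (SignedSum-++ (SignedSum-++ (SignedSum-replicate⁺ p₁ g) (SignedSum-replicate⁻ q₁ g))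
                    (SignedSum-++ (SignedSum-replicate⁺ p₂ y) (SignedSum-replicate⁻ q₂ y)))

  SignedSum-letters : ∀ {s z} → All Letter s → SignedSum s z →
    ∃[ p₁ ] ∃[ q₁ ] ∃[ p₂ ] ∃[ q₂ ] (s ↭ monomial (p₁ + q₁) (p₂ + q₂) × z ≡ signedValue p₁ q₁ p₂ q₂)
  SignedSum-letters [] ss-nil = 0 , 0 , 0 , 0 , ↭-refl , refl
  SignedSum-letters (inj₁ refl ∷ letters) (ss-plus _ ss) with SignedSum-letters letters ss
  ... | p₁ , q₁ , p₂ , q₂ , s↭ , z≡ =
    suc p₁ , q₁ , p₂ , q₂ , prep g s↭ , trans (cong (ℤ._+_ (+ toℕ g)) z≡) (plus-g (+ toℕ g) (+ (p₁ * toℕ g)) (+ (q₁ * toℕ g)) Y)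
    where
    Y : ℤ
    Y = + (p₂ * toℕ y) ℤ.- + (q₂ * toℕ y)
    plus-g : ∀ G A B Y → G ℤ.+ ((A ℤ.- B) ℤ.+ Y) ≡ ((G ℤ.+ A) ℤ.- B) ℤ.+ Y
    plus-g = ℤ-Solver.solve-∀
  SignedSum-letters (inj₂ refl ∷ letters) (ss-plus _ ss) with SignedSum-letters letters ss
  ... | p₁ , q₁ , p₂ , q₂ , s↭ , z≡ =
    p₁ , q₁ , suc p₂ , q₂ , ↭-trans (prep y s↭) (y∷monomial _ _) ,
    trans (cong (ℤ._+_ (+ toℕ y)) z≡) (plus-y (+ toℕ y) X (+ (p₂ * toℕ y)) (+ (q₂ * toℕ y)))
    where
    X : ℤ
    X = + (p₁ * toℕ g) ℤ.- + (q₁ * toℕ g)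
    plus-y : ∀ Y X A B → Y ℤ.+ (X ℤ.+ (A ℤ.- B)) ≡ X ℤ.+ ((Y ℤ.+ A) ℤ.- B)
    plus-y = ℤ-Solver.solve-∀
  SignedSum-letters {_ ∷ s} (inj₁ refl ∷ letters) (ss-minus _ ss) with SignedSum-letters letters ss
  ... | p₁ , q₁ , p₂ , q₂ , s↭ , z≡ =
    p₁ , suc q₁ , p₂ , q₂ , subst (λ i → g ∷ s ↭ monomial i (p₂ + q₂)) (sym (+-suc p₁ q₁)) (prep g s↭) ,
    trans (cong (ℤ._+_ (- + toℕ g)) z≡) (minus-g (+ toℕ g) (+ (p₁ * toℕ g)) (+ (q₁ * toℕ g)) Y)
    where
    Y : ℤ
    Y = + (p₂ * toℕ y) ℤ.- + (q₂ * toℕ y)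
    minus-g : ∀ G A B Y → ℤ.- G ℤ.+ ((A ℤ.- B) ℤ.+ Y) ≡ (A ℤ.- (G ℤ.+ B)) ℤ.+ Y
    minus-g = ℤ-Solver.solve-∀
  SignedSum-letters {_ ∷ s} (inj₂ refl ∷ letters) (ss-minus _ ss) with SignedSum-letters letters ss
  ... | p₁ , q₁ , p₂ , q₂ , s↭ , z≡ =
    p₁ , q₁ , p₂ , suc q₂ ,
    subst (λ j → y ∷ s ↭ monomial (p₁ + q₁) j) (sym (+-suc p₂ q₂)) (↭-trans (prep y s↭) (y∷monomial _ _)) ,
    trans (cong (ℤ._+_ (- + toℕ y)) z≡) (minus-y (+ toℕ y) X (+ (p₂ * toℕ y)) (+ (q₂ * toℕ y)))
    where
    X : ℤ
    X = + (p₁ * toℕ g) ℤ.- + (q₁ * toℕ g)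
    minus-y : ∀ Y X A B → ℤ.- Y ℤ.+ (X ℤ.+ (A ℤ.- B)) ≡ X ℤ.+ (A ℤ.- (Y ℤ.+ B))
    minus-y = ℤ-Solver.solve-∀

  ZeroSum : ℕ → ℕ → Set
  ZeroSum i j = ∃[ p₁ ] ∃[ q₁ ] ∃[ p₂ ] ∃[ q₂ ]
    (p₁ + q₁ ≡ i × p₂ + q₂ ≡ j × + n ∣ signedValue p₁ q₁ p₂ q₂)

  B±⇒monomial : ∀ {s} → B± s → ∃[ i ] ∃[ j ] (s ↭ monomial i j × ZeroSum i j)
  B±⇒monomial (letters , z , ss , n∣z) with SignedSum-letters letters ss
  ... | p₁ , q₁ , p₂ , q₂ , s↭ , refl =
    p₁ + q₁ , p₂ + q₂ , s↭ , p₁ , q₁ , p₂ , q₂ , refl , refl , signed-∣ _ n∣z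

  ZeroSum⇒B± : ∀ {i j} → ZeroSum i j → B± (monomial i j)
  ZeroSum⇒B± {i} {j} (p₁ , q₁ , p₂ , q₂ , refl , refl , n∣z) =
    All.++⁺ (All.replicate⁺ i (inj₁ refl)) (All.replicate⁺ j (inj₂ refl)) ,
    signedValue p₁ q₁ p₂ q₂ , SignedSum-monomial p₁ q₁ p₂ q₂ , unsigned-∣ _ n∣z

  atom⇒unsplittable : ∀ {x} → IsAtom B± x →
    ∃[ i ] ∃[ j ] (x ↭ monomial i j × ZeroSum i j × 0 < i + j × ¬ Splits ZeroSum i j)
  atom⇒unsplittable {x} (x∈B± , x≁[] , irreducible) with B±⇒monomial x∈B±
  ... | i , j , x↭ , zs = i , j , x↭ , zs , n≢0⇒n>0 (x≁[] ∘′ ↭monomial-empty i j x↭) , unsplittable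
    where
    unsplittable : ¬ Splits ZeroSum i j
    unsplittable (i₁ , j₁ , i₂ , j₂ , i≡ , j≡ , zs₁ , zs₂ , 0<i₁+j₁ , 0<i₂+j₂)
      with irreducible (monomial i₁ j₁) (monomial i₂ j₂) (ZeroSum⇒B± zs₁) (ZeroSum⇒B± zs₂)
             (↭-trans x↭ (subst₂ (λ i j → monomial i j ↭ _) i≡ j≡ (monomial-+ i₁ i₂ j₁ j₂)))
    ... | inj₁ m₁↭[] = <⇒≢ 0<i₁+j₁ (sym (monomial↭[]⇒empty i₁ j₁ m₁↭[]))
    ... | inj₂ m₂↭[] = <⇒≢ 0<i₂+j₂ (sym (monomial↭[]⇒empty i₂ j₂ m₂↭[]))

  unsplittable⇒atom : toℕ g < toℕ y → ∀ {i j} →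
    ZeroSum i j → 0 < i + j → ¬ Splits ZeroSum i j → IsAtom B± (monomial i j)
  unsplittable⇒atom g<y {i} {j} zs 0<i+j unsplittable =
    ZeroSum⇒B± zs , (λ m↭[] → <⇒≢ 0<i+j (sym (monomial↭[]⇒empty i j m↭[]))) , irreducible
    where
    irreducible : ∀ s t → B± s → B± t → monomial i j ↭ s ++ t → s ↭ [] ⊎ t ↭ []
    irreducible s t s∈B± t∈B± m↭s++t with B±⇒monomial s∈B± | B±⇒monomial t∈B±
    ... | i₁ , j₁ , s↭ , zs₁ | i₂ , j₂ , t↭ , zs₂
      with monomial-injective g<y (↭-trans m↭s++t (↭-trans (↭.++⁺ s↭ t↭) (↭-sym (monomial-+ i₁ i₂ j₁ j₂))))
         | i₁ + j₁ ≟ 0 | i₂ + j₂ ≟ 0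
    ... | _           | yes s-empty | _           = inj₁ (↭monomial-empty i₁ j₁ s↭ s-empty)
    ... | _           | no  _       | yes t-empty = inj₂ (↭monomial-empty i₂ j₂ t↭ t-empty)
    ... | i≡ , j≡     | no  s≢[]    | no  t≢[]    = ⊥-elim (unsplittable
      (i₁ , j₁ , i₂ , j₂ , sym i≡ , sym j≡ , zs₁ , zs₂ , n≢0⇒n>0 s≢[] , n≢0⇒n>0 t≢[]))

  zeroSum-sameSigns : ∀ {i j} → n ℕ.∣ i * toℕ g + j * toℕ y → ZeroSum i j
  zeroSum-sameSigns {i} {j} n∣ = i , 0 , j , 0 , +-identityʳ i , +-identityʳ j ,
    signed-∣ _ (subst (n ℕ.∣_) (sym (cong₂ _+_ (+-identityʳ (i * toℕ g)) (+-identityʳ (j * toℕ y)))) n∣)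

  zeroSum-oppositeSigns : ∀ {i j} → + n ∣ + (i * toℕ g) ℤ.- + (j * toℕ y) → ZeroSum i j
  zeroSum-oppositeSigns {i} {j} n∣ = i , 0 , 0 , j , +-identityʳ i , refl ,
    subst (+ n ∣_) (sym (drop-zeros (+ (i * toℕ g)) (+ (j * toℕ y)))) n∣
    where
    drop-zeros : ∀ A B → (A ℤ.- + 0) ℤ.+ (+ 0 ℤ.- B) ≡ A ℤ.- B
    drop-zeros = ℤ-Solver.solve-∀

  zeroSum-gg : ZeroSum 2 0
  zeroSum-gg = 1 , 1 , 0 , 0 , refl , refl ,
    subst (+ n ∣_) (sym (cancel (+ (1 * toℕ g)))) (signed-∣ (+ 0) (ℕ._∣0 n))
    where
    cancel : ∀ A → (A ℤ.- A) ℤ.+ (+ 0 ℤ.- + 0) ≡ + 0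
    cancel = ℤ-Solver.solve-∀

  zeroSum-yy : ZeroSum 0 2
  zeroSum-yy = 0 , 0 , 1 , 1 , refl , refl ,
    subst (+ n ∣_) (sym (cancel (+ (1 * toℕ y)))) (signed-∣ (+ 0) (ℕ._∣0 n))
    where
    cancel : ∀ A → (+ 0 ℤ.- + 0) ℤ.+ (A ℤ.- A) ≡ + 0
    cancel = ℤ-Solver.solve-∀

  -- Opposite signs on two copies of the same letter cancel; otherwise the signs are constant on each letter.
  zeroSum-cases : ∀ {i j} → ZeroSum i j →
    (∃[ i₀ ] i ≡ 2 + i₀ × ZeroSum i₀ j) ⊎ (∃[ j₀ ] j ≡ 2 + j₀ × ZeroSum i j₀) ⊎
    n ℕ.∣ i * toℕ g + j * toℕ y ⊎ + n ∣ + (i * toℕ g) ℤ.- + (j * toℕ y)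
  zeroSum-cases (suc p₁ , suc q₁ , p₂ , q₂ , refl , refl , n∣) =
    inj₁ (p₁ + q₁ , cong suc (+-suc p₁ q₁) , p₁ , q₁ , p₂ , q₂ , refl , refl ,
      subst (+ n ∣_) (cancel (+ toℕ g) (+ (p₁ * toℕ g)) (+ (q₁ * toℕ g)) (+ (p₂ * toℕ y) ℤ.- + (q₂ * toℕ y))) n∣)
    where
    cancel : ∀ G A B Y → ((G ℤ.+ A) ℤ.- (G ℤ.+ B)) ℤ.+ Y ≡ (A ℤ.- B) ℤ.+ Y
    cancel = ℤ-Solver.solve-∀
  zeroSum-cases (p₁ , q₁ , suc p₂ , suc q₂ , refl , refl , n∣) =
    inj₂ (inj₁ (p₂ + q₂ , cong suc (+-suc p₂ q₂) , p₁ , q₁ , p₂ , q₂ , refl , refl ,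
      subst (+ n ∣_) (cancel (+ toℕ y) (+ (p₁ * toℕ g) ℤ.- + (q₁ * toℕ g)) (+ (p₂ * toℕ y)) (+ (q₂ * toℕ y))) n∣))
    where
    cancel : ∀ Y X A B → X ℤ.+ ((Y ℤ.+ A) ℤ.- (Y ℤ.+ B)) ≡ X ℤ.+ (A ℤ.- B)
    cancel = ℤ-Solver.solve-∀
  zeroSum-cases (p₁ , zero , p₂ , zero , refl , refl , n∣) =
    inj₂ (inj₂ (inj₁ (subst (n ℕ.∣_) (drop-zeros p₁ p₂ (toℕ g) (toℕ y)) (unsigned-∣ _ n∣))))
    where
    drop-zeros : ∀ p₁ p₂ u v → (p₁ * u + 0) + (p₂ * v + 0) ≡ (p₁ + 0) * u + (p₂ + 0) * v
    drop-zeros = ℕ-Solver.solve-∀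
  zeroSum-cases (zero , q₁ , zero , q₂ , refl , refl , n∣) =
    inj₂ (inj₂ (inj₁ (unsigned-∣ _ (subst (+ n ∣_) negated (∣m⇒∣-m n∣)))))
    where
    negate : ∀ A B → ℤ.- ((+ 0 ℤ.- A) ℤ.+ (+ 0 ℤ.- B)) ≡ A ℤ.+ B
    negate = ℤ-Solver.solve-∀
    negated : ℤ.- signedValue 0 q₁ 0 q₂ ≡ + (q₁ * toℕ g) ℤ.+ + (q₂ * toℕ y)
    negated = negate (+ (q₁ * toℕ g)) (+ (q₂ * toℕ y))
  zeroSum-cases (p₁ , zero , zero , q₂ , refl , refl , n∣) =
    inj₂ (inj₂ (inj₂ (subst (+ n ∣_) (trans (drop-zeros (+ (p₁ * toℕ g)) (+ (q₂ * toℕ y)))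
      (cong (λ i → + (i * toℕ g) ℤ.- + (q₂ * toℕ y)) (sym (+-identityʳ p₁)))) n∣)))
    where
    drop-zeros : ∀ A B → (A ℤ.- + 0) ℤ.+ (+ 0 ℤ.- B) ≡ A ℤ.- B
    drop-zeros = ℤ-Solver.solve-∀
  zeroSum-cases (zero , q₁ , p₂ , zero , refl , refl , n∣) =
    inj₂ (inj₂ (inj₂ (subst (+ n ∣_) (trans (negate (+ (q₁ * toℕ g)) (+ (p₂ * toℕ y)))
      (cong (λ j → + (q₁ * toℕ g) ℤ.- + (j * toℕ y)) (sym (+-identityʳ p₂)))) (∣m⇒∣-m n∣))))
    where
    negate : ∀ A B → ℤ.- ((+ 0 ℤ.- A) ℤ.+ (B ℤ.- + 0)) ≡ A ℤ.- B
    negate = ℤ-Solver.solve-∀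

module SquarePlusOne (d : ℕ) (d-odd : Odd d) where

  a n : ℕ
  a = suc d
  n = a * a + 1

  0<d : 0 < d
  0<d = n≢0⇒n>0 (d-odd 0)

  a*a<n : a * a < n
  a*a<n = m<m+n (a * a) (s≤s z≤n)

  a<n : a < n
  a<n = ≤-<-trans (m≤m*n a a) a*a<n

  1<n : 1 < n
  1<n = <-trans (s≤s 0<d) a<n

  n+a*0≡n : n + a * 0 ≡ n
  n+a*0≡n = trans (cong (λ m → n + m) (*-zeroʳ a)) (+-identityʳ n)

  opaque
    g y : Fin n
    g = fromℕ< 1<n
    y = fromℕ< a<n

    toℕ-g : toℕ g ≡ 1
    toℕ-g = toℕ-fromℕ< 1<n

    toℕ-y : toℕ y ≡ a
    toℕ-y = toℕ-fromℕ< a<n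

  open TwoLetters g y

  g<y : toℕ g < toℕ y
  g<y = subst₂ _<_ (sym toℕ-g) (sym toℕ-y) (s≤s 0<d)

  Balanced : ℕ → ℕ → Set
  Balanced i j = n ℕ.∣ i + a * j

  sameSigns≡balanced : ∀ i j → i * toℕ g + j * toℕ y ≡ i + a * j
  sameSigns≡balanced i j rewrite toℕ-g | toℕ-y =
    cong₂ _+_ (*-identityʳ i) (*-comm j a)

  oppositeSigns≡ : ∀ i j → + (i * toℕ g) ℤ.- + (j * toℕ y) ≡ + i ℤ.- + a ℤ.* + j
  oppositeSigns≡ i j rewrite toℕ-g | toℕ-y =
    cong₂ ℤ._-_ (cong +_ (*-identityʳ i)) (trans (cong +_ (*-comm j a)) (ℤₚ.pos-* a j))

  +balanced≡ : ∀ i j → + (i + a * j) ≡ + i ℤ.+ + a ℤ.* + j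
  +balanced≡ i j = trans (ℤₚ.pos-+ i (a * j)) (cong (ℤ._+_ (+ i)) (ℤₚ.pos-* a j))

  +n≡ : + n ≡ + a ℤ.* + a ℤ.+ + 1
  +n≡ = trans (ℤₚ.pos-+ (a * a) 1) (cong (λ m → m ℤ.+ + 1) (ℤₚ.pos-* a a))

  -- Since a² ≡ -1 (mod n), multiplication by a maps i - a j to j + a i and back.
  n∣a*X+n*Y : ∀ {X} Y → + n ∣ X → + n ∣ + a ℤ.* X ℤ.+ + n ℤ.* Y
  n∣a*X+n*Y Y n∣X = ∣m∣n⇒∣m+n (∣n⇒∣m*n (+ a) n∣X) (∣m⇒∣m*n Y ∣-refl)

  balanced-flip⇒opposite : ∀ i j → + n ∣ + (j + a * i) → + n ∣ + i ℤ.- + a ℤ.* + j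
  balanced-flip⇒opposite i j n∣ =
    subst (+ n ∣_) (sym as-combination) (n∣a*X+n*Y (+ i) (∣m⇒∣-m (subst (+ n ∣_) (+balanced≡ j i) n∣)))
    where
    identity : ∀ A I J → I ℤ.- A ℤ.* J ≡ A ℤ.* (ℤ.- (J ℤ.+ A ℤ.* I)) ℤ.+ (A ℤ.* A ℤ.+ + 1) ℤ.* I
    identity = ℤ-Solver.solve-∀
    as-combination : + i ℤ.- + a ℤ.* + j ≡ + a ℤ.* (ℤ.- (+ j ℤ.+ + a ℤ.* + i)) ℤ.+ + n ℤ.* + i
    as-combination rewrite +n≡ = identity (+ a) (+ i) (+ j)

  opposite⇒balanced-flip : ∀ i j → + n ∣ + i ℤ.- + a ℤ.* + j → + n ∣ + (j + a * i)
  opposite⇒balanced-flip i j n∣ =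
    subst (+ n ∣_) (sym (trans (+balanced≡ j i) as-combination)) (n∣a*X+n*Y (+ j) n∣)
    where
    identity : ∀ A I J → J ℤ.+ A ℤ.* I ≡ A ℤ.* (I ℤ.- A ℤ.* J) ℤ.+ (A ℤ.* A ℤ.+ + 1) ℤ.* J
    identity = ℤ-Solver.solve-∀
    as-combination : + j ℤ.+ + a ℤ.* + i ≡ + a ℤ.* (+ i ℤ.- + a ℤ.* + j) ℤ.+ + n ℤ.* + j
    as-combination rewrite +n≡ = identity (+ a) (+ i) (+ j)

  balanced⇒zeroSum : ∀ {i j} → Balanced i j → ZeroSum i j
  balanced⇒zeroSum {i} {j} n∣ = zeroSum-sameSigns (subst (n ℕ.∣_) (sym (sameSigns≡balanced i j)) n∣)

  balanced-flip⇒zeroSum : ∀ {i j} → Balanced j i → ZeroSum i j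
  balanced-flip⇒zeroSum {i} {j} n∣ =
    zeroSum-oppositeSigns (subst (+ n ∣_) (sym (oppositeSigns≡ i j)) (balanced-flip⇒opposite i j (signed-∣ _ n∣)))

  zeroSum-cases′ : ∀ {i j} → ZeroSum i j →
    (∃[ i₀ ] i ≡ 2 + i₀ × ZeroSum i₀ j) ⊎ (∃[ j₀ ] j ≡ 2 + j₀ × ZeroSum i j₀) ⊎ Balanced i j ⊎ Balanced j i
  zeroSum-cases′ {i} {j} zs = ⊎-map id (⊎-map id (⊎-map same opposite)) (zeroSum-cases zs)
    where
    same : n ℕ.∣ i * toℕ g + j * toℕ y → Balanced i j
    same = subst (n ℕ.∣_) (sameSigns≡balanced i j)
    opposite : + n ∣ + (i * toℕ g) ℤ.- + (j * toℕ y) → Balanced j i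
    opposite n∣ = unsigned-∣ _ (opposite⇒balanced-flip i j (subst (+ n ∣_) (oppositeSigns≡ i j) n∣))

  n∤ : ∀ {m} → 0 < m → m < n → ¬ n ℕ.∣ m
  n∤ 0<m m<n n∣m = <⇒≱ m<n (ℕ.∣⇒≤ {{>-nonZero 0<m}} n∣m)

  -- a (a j) + j = n j
  n∤a*j : ∀ {j} → 0 < j → j < n → ¬ n ℕ.∣ a * j
  n∤a*j {j} 0<j j<n n∣aj = n∤ 0<j j<n
    (ℕ.∣m+n∣m⇒∣n (subst (n ℕ.∣_) (expand d j) (ℕ.n∣m*n j)) (ℕ.∣n⇒∣m*n a n∣aj))
    where
    expand : ∀ d j → j * (suc d * suc d + 1) ≡ suc d * (suc d * j) + j
    expand = ℕ-Solver.solve-∀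

  -- n = 2 + (a + 1) d, so the complement of j copies of a in n has length 2 + (a + 1 - j) d.
  twoPlus-complement : ∀ {i j} → i + a * j ≡ n → j ≤ suc a → TwoPlusMultipleOf d (i + j)
  twoPlus-complement {i} {j} i+aj≡n j≤ with m≤n⇒∃[o]m+o≡n j≤
  ... | t , j+t≡ = t , +-cancelʳ-≡ (d * j) (i + j) (2 + t * d) (begin
    i + j + d * j                  ≡⟨ +-assoc i j (d * j) ⟩
    i + a * j                      ≡⟨ i+aj≡n ⟩
    n                              ≡⟨ n≡ d ⟩
    2 + d * suc a                  ≡⟨ cong (λ m → 2 + d * m) (sym j+t≡) ⟩
    2 + d * (j + t)                ≡⟨ regroup d j t ⟩
    2 + t * d + d * j              ∎)
    where
    open ≡-Reasoning
    n≡ : ∀ d → suc d * suc d + 1 ≡ 2 + d * suc (suc d)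
    n≡ = ℕ-Solver.solve-∀
    regroup : ∀ d j t → 2 + d * (j + t) ≡ 2 + t * d + d * j
    regroup = ℕ-Solver.solve-∀

  twoPlus-n : TwoPlusMultipleOf d n
  twoPlus-n = subst (TwoPlusMultipleOf d) (+-identityʳ n) (twoPlus-complement n+a*0≡n z≤n)

  balanced-peel : ∀ {i j i₁ j₁ i₂ j₂} → i₁ + i₂ ≡ i → j₁ + j₂ ≡ j →
    Balanced i j → Balanced i₁ j₁ → Balanced i₂ j₂
  balanced-peel {i₁ = i₁} {j₁} {i₂} {j₂} refl refl n∣ n∣₁ =
    ℕ.∣m+n∣m⇒∣n (subst (n ℕ.∣_) (regroup a i₁ i₂ j₁ j₂) n∣) n∣₁
    where
    regroup : ∀ a i₁ i₂ j₁ j₂ → (i₁ + i₂) + a * (j₁ + j₂) ≡ (i₁ + a * j₁) + (i₂ + a * j₂)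
    regroup = ℕ-Solver.solve-∀

  peel-or-whole : ∀ {i j i₁ j₁ i₂ j₂} → Balanced i j → Balanced i₁ j₁ → i₁ + i₂ ≡ i → j₁ + j₂ ≡ j →
    0 < i₁ + j₁ → TwoPlusMultipleOf d (i₁ + j₁) → TwoPlusMultipleOf d (i + j) ⊎ Splits Balanced i j
  peel-or-whole {i₁ = i₁} {j₁} {i₂} {j₂} b b₁ i≡ j≡ =
    split-or-whole {Balanced} {i₁ = i₁} {j₁} {i₂} {j₂} b₁ (balanced-peel {i₁ = i₁} {j₁} {i₂} {j₂} i≡ j≡ b b₁) i≡ j≡

  balanced-split-j≤a : ∀ {i j} → Balanced i j → 0 < i + j → j ≤ a →
    TwoPlusMultipleOf d (i + j) ⊎ Splits Balanced i j
  balanced-split-j≤a {i} {j} b 0<i+j j≤a =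
    peel-or-whole {i₁ = i₁} {j} {r} {0} b (subst (n ℕ.∣_) (sym i₁+aj≡n) ℕ.∣-refl) i₁+r≡i (+-identityʳ j)
      (≤-trans (m<n⇒0<n∸m aj<n) (m≤m+n i₁ j)) (twoPlus-complement i₁+aj≡n (m≤n⇒m≤1+n j≤a))
    where
    aj<n : a * j < n
    aj<n = ≤-<-trans (*-monoʳ-≤ a j≤a) a*a<n
    n≤i+aj : n ≤ i + a * j
    n≤i+aj = ℕ.∣⇒≤ {{>-nonZero (<-≤-trans 0<i+j (+-monoʳ-≤ i (m≤n*m j a)))}} b
    i₁ r : ℕ
    i₁ = n ∸ a * j
    r  = (i + a * j) ∸ n
    i₁+aj≡n : i₁ + a * j ≡ n
    i₁+aj≡n = m∸n+n≡m (<⇒≤ aj<n)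
    i₁+r≡i : i₁ + r ≡ i
    i₁+r≡i = +-cancelʳ-≡ (a * j) (i₁ + r) i (begin
      i₁ + r + a * j      ≡⟨ +-assoc i₁ r (a * j) ⟩
      i₁ + (r + a * j)    ≡⟨ cong (λ m → i₁ + m) (+-comm r (a * j)) ⟩
      i₁ + (a * j + r)    ≡⟨ +-assoc i₁ (a * j) r ⟨
      i₁ + a * j + r      ≡⟨ cong (_+ r) i₁+aj≡n ⟩
      n + r               ≡⟨ m+[n∸m]≡n n≤i+aj ⟩
      i + a * j           ∎)
      where open ≡-Reasoning

  -- Peel off y^n, g^n or g y^a if present; otherwise the monomial is g^(n - a j) y^j times g^r with n ∣ r.
  balanced-split : ∀ i j → Balanced i j → 0 < i + j → TwoPlusMultipleOf d (i + j) ⊎ Splits Balanced i j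
  balanced-split i j b 0<i+j with n ≤? j | n ≤? i | a ≤? j
  ... | yes n≤j | _ | _ =
    let j₀ , n+j₀≡j = m≤n⇒∃[o]m+o≡n n≤j
    in peel-or-whole {i₁ = 0} {n} {i} {j₀} b (ℕ.n∣m*n a) refl n+j₀≡j (<-trans (s≤s z≤n) 1<n) twoPlus-n
  ... | no _ | yes n≤i | _ =
    let i₀ , n+i₀≡i = m≤n⇒∃[o]m+o≡n n≤i
    in peel-or-whole {i₁ = n} {0} {i₀} {j} b (subst (n ℕ.∣_) (sym n+a*0≡n) ℕ.∣-refl) n+i₀≡i refl
         (subst (0 <_) (sym (+-identityʳ n)) (<-trans (s≤s z≤n) 1<n))
         (subst (TwoPlusMultipleOf d) (sym (+-identityʳ n)) twoPlus-n)
  balanced-split zero j b 0<j | no n≰j | no _ | yes _ = ⊥-elim (n∤a*j 0<j (≰⇒> n≰j) b)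
  balanced-split (suc i₀) j b _ | no _ | no _ | yes a≤j =
    let j₀ , a+j₀≡j = m≤n⇒∃[o]m+o≡n a≤j
    in peel-or-whole {i₁ = 1} {a} {i₀} {j₀} b (subst (n ℕ.∣_) (+-comm (a * a) 1) ℕ.∣-refl) refl a+j₀≡j
         (s≤s z≤n) (twoPlus-complement {1} {a} (+-comm 1 (a * a)) (n≤1+n a))
  ... | no _ | no _ | no a≰j = balanced-split-j≤a b 0<i+j (<⇒≤ (≰⇒> a≰j))

  zeroSum-split : ∀ {i j} → ZeroSum i j → 0 < i + j → TwoPlusMultipleOf d (i + j) ⊎ Splits ZeroSum i j
  zeroSum-split {i} {j} zs 0<i+j with zeroSum-cases′ zs
  ... | inj₁ (i₀ , refl , zs₀) =
    split-or-whole {ZeroSum} {i₁ = 2} {0} {i₀} {j} zeroSum-gg zs₀ refl refl (s≤s z≤n) (0 , refl)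
  ... | inj₂ (inj₁ (j₀ , refl , zs₀)) =
    split-or-whole {ZeroSum} {i₁ = 0} {2} {i} {j₀} zeroSum-yy zs₀ refl refl (s≤s z≤n) (0 , refl)
  ... | inj₂ (inj₂ (inj₁ b)) = ⊎-map id (Splits-map balanced⇒zeroSum) (balanced-split i j b 0<i+j)
  ... | inj₂ (inj₂ (inj₂ b)) =
    ⊎-map (subst (TwoPlusMultipleOf d) (+-comm j i)) (Splits-flip balanced-flip⇒zeroSum)
      (balanced-split j i b (subst (0 <_) (+-comm i j) 0<i+j))

  atom-length : ∀ x → IsAtom B± x → TwoPlusMultipleOf d (length x)
  atom-length x atom with atom⇒unsplittable atom
  ... | i , j , x↭ , zs , 0<i+j , unsplittable with zeroSum-split zs 0<i+j
  ...   | inj₁ (c , i+j≡) = c , trans (↭.↭-length x↭) (trans (length-monomial i j) i+j≡)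
  ...   | inj₂ split      = ⊥-elim (unsplittable split)

  ¬zeroSum-g : ¬ ZeroSum 1 0
  ¬zeroSum-g zs with zeroSum-cases′ zs
  ... | inj₁ (_ , () , _)
  ... | inj₂ (inj₁ (_ , () , _))
  ... | inj₂ (inj₂ (inj₁ n∣1+a*0)) = n∤ (s≤s z≤n) 1<n (subst (n ℕ.∣_) (cong suc (*-zeroʳ a)) n∣1+a*0)
  ... | inj₂ (inj₂ (inj₂ n∣a*1))   = n∤ (s≤s z≤n) a<n (subst (n ℕ.∣_) (*-identityʳ a) n∣a*1)

  ¬zeroSum-gᵐy : ∀ m → m < a → ¬ ZeroSum m 1
  ¬zeroSum-gᵐy m m<a zs with zeroSum-cases′ zs
  ¬zeroSum-gᵐy zero          _   _ | inj₁ (_ , () , _)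
  ¬zeroSum-gᵐy (suc zero)    _   _ | inj₁ (_ , () , _)
  ¬zeroSum-gᵐy (suc (suc m)) m<a _ | inj₁ (_ , refl , zs₀) = ¬zeroSum-gᵐy m (m+n≤o⇒n≤o 2 m<a) zs₀
  ¬zeroSum-gᵐy m _   _ | inj₂ (inj₁ (_ , () , _))
  ¬zeroSum-gᵐy m m<a _ | inj₂ (inj₂ (inj₁ n∣m+a*1)) =
    n∤ (≤-trans (s≤s z≤n) (m≤n+m (a * 1) m)) m+a*1<n n∣m+a*1
    where
    m+a*1<n : m + a * 1 < n
    m+a*1<n = begin-strict
      m + a * 1  <⟨ +-monoˡ-< (a * 1) m<a ⟩
      a + a * 1  ≡⟨ cong (λ k → a + k) (*-identityʳ a) ⟩
      a + a      ≤⟨ +-monoʳ-≤ a (m≤n*m a d {{>-nonZero 0<d}}) ⟩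
      a * a      <⟨ a*a<n ⟩
      n          ∎
      where open ≤-Reasoning
  ¬zeroSum-gᵐy m m<a _ | inj₂ (inj₂ (inj₂ n∣1+a*m)) =
    n∤ (s≤s z≤n) (subst (1 + a * m <_) (+-comm 1 (a * a)) (s≤s (*-monoʳ-< a m<a))) n∣1+a*m

  unsplittable-gg : ¬ Splits ZeroSum 2 0
  unsplittable-gg (i₁ , zero , i₂ , zero , i₁+i₂≡2 , refl , zs₁ , _ , 0<i₁+0 , 0<i₂+0) =
    ¬zeroSum-g (subst (λ k → ZeroSum k 0) i₁≡1 zs₁)
    where
    i₁≡1 : i₁ ≡ 1
    i₁≡1 = ≤-antisym (≤-pred (subst (i₁ <_) i₁+i₂≡2 (m<m+n i₁ (subst (0 <_) (+-identityʳ i₂) 0<i₂+0))))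
                     (subst (0 <_) (+-identityʳ i₁) 0<i₁+0)
  unsplittable-gg (_ , zero  , _ , suc _ , _ , () , _)
  unsplittable-gg (_ , suc _ , _ , _     , _ , () , _)

  unsplittable-yy : ¬ Splits ZeroSum 0 2
  unsplittable-yy (zero , j₁ , zero , j₂ , refl , j₁+j₂≡2 , zs₁ , _ , 0<j₁ , 0<j₂) =
    ¬zeroSum-gᵐy 0 (s≤s z≤n) (subst (ZeroSum 0) j₁≡1 zs₁)
    where
    j₁≡1 : j₁ ≡ 1
    j₁≡1 = ≤-antisym (≤-pred (subst (j₁ <_) j₁+j₂≡2 (m<m+n j₁ 0<j₂))) 0<j₁
  unsplittable-yy (zero  , _ , suc _ , _ , () , _)
  unsplittable-yy (suc _ , _ , _     , _ , () , _)

  unsplittable-gᵃy : ¬ Splits ZeroSum a 1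
  unsplittable-gᵃy (i₁ , suc zero , i₂ , zero , i₁+i₂≡a , refl , zs₁ , _ , _ , 0<i₂+0) =
    ¬zeroSum-gᵐy i₁ (subst (i₁ <_) i₁+i₂≡a (m<m+n i₁ (subst (0 <_) (+-identityʳ i₂) 0<i₂+0))) zs₁
  unsplittable-gᵃy (i₁ , zero , i₂ , suc zero , i₁+i₂≡a , refl , _ , zs₂ , 0<i₁+0 , _) =
    ¬zeroSum-gᵐy i₂ (subst (i₂ <_) (trans (+-comm i₂ i₁) i₁+i₂≡a) (m<m+n i₂ (subst (0 <_) (+-identityʳ i₁) 0<i₁+0))) zs₂
  unsplittable-gᵃy (_ , zero     , _ , zero        , _ , () , _)
  unsplittable-gᵃy (_ , zero     , _ , suc (suc _) , _ , () , _)
  unsplittable-gᵃy (_ , suc zero , _ , suc _       , _ , () , _)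
  unsplittable-gᵃy (_ , suc (suc _) , _ , _        , _ , () , _)

  gg yy gᵃy : Seq n
  gg  = monomial 2 0
  yy  = monomial 0 2
  gᵃy = monomial a 1

  atom-gg : IsAtom B± gg
  atom-gg = unsplittable⇒atom g<y zeroSum-gg (s≤s z≤n) unsplittable-gg

  atom-yy : IsAtom B± yy
  atom-yy = unsplittable⇒atom g<y zeroSum-yy (s≤s z≤n) unsplittable-yy

  atom-gᵃy : IsAtom B± gᵃy
  atom-gᵃy = unsplittable⇒atom g<y (balanced-flip⇒zeroSum (subst (n ℕ.∣_) (+-comm (a * a) 1) ℕ.∣-refl))
    (s≤s z≤n) unsplittable-gᵃy

  -- X = (g^a y)² = y² (g²)^a
  X : Seq n
  X = concat (yy ∷ replicate a gg)

  concat-replicate-gg : ∀ k → concat (replicate k gg) ≡ replicate (k + k) g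
  concat-replicate-gg zero    = refl
  concat-replicate-gg (suc k) =
    trans (cong (λ s → g ∷ g ∷ s) (concat-replicate-gg k)) (cong (λ m → g ∷ replicate m g) (sym (+-suc k k)))

  gᵃy²↭X : concat (gᵃy ∷ gᵃy ∷ []) ↭ X
  gᵃy²↭X = begin
    gᵃy ++ gᵃy ++ []                       ≡⟨ cong (gᵃy ++_) (++-identityʳ gᵃy) ⟩
    gᵃy ++ gᵃy                             ↭⟨ monomial-+ a a 1 1 ⟨
    replicate (a + a) g ++ y ∷ y ∷ []      ↭⟨ ↭.++-comm (replicate (a + a) g) (y ∷ y ∷ []) ⟩
    y ∷ y ∷ replicate (a + a) g            ≡⟨ cong (λ s → y ∷ y ∷ s) (concat-replicate-gg a) ⟨
    X                                      ∎
    where open PermutationReasoning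

  length-2 : InLengths B± X 2
  length-2 = gᵃy ∷ gᵃy ∷ [] , refl , atom-gᵃy ∷ atom-gᵃy ∷ [] , gᵃy²↭X

  atoms-y²[g²]ᵃ : All (IsAtom B±) (yy ∷ replicate a gg)
  atoms-y²[g²]ᵃ = atom-yy ∷ All.replicate⁺ a atom-gg

  length-2+d : InLengths B± X (2 + d)
  length-2+d = yy ∷ replicate a gg , cong suc (length-replicate a) , atoms-y²[g²]ᵃ , ↭-refl

  open AtomLengths B± d atom-length

  d∈Δ* : InDeltaStar n d
  d∈Δ* = B± , B±-submonoid ,
    (X , concat-atoms B±-submonoid atoms-y²[g²]ᵃ ,
     lengths-differing-by-d⇒Δ d-odd length-2 length-2+d) ,
    λ _ → Δ-lower-bound d-odd
    where
    B±-submonoid : IsDivClosedSubmonoid n B±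
    B±-submonoid = BpmOver-isDivClosedSubmonoid Letter

[1+2e]²+1-even : ∀ e → (suc (e + e) * suc (e + e) + 1) % 2 ≡ 0
[1+2e]²+1-even e = trans (cong (_% 2) (expand e)) (m*n%n≡0 (e * e + e * e + e + e + 1) 2)
  where
  expand : ∀ e → suc (e + e) * suc (e + e) + 1 ≡ (e * e + e * e + e + e + 1) * 2
  expand = ℕ-Solver.solve-∀

lemma4p11 : (n a : ℕ) → n % 2 ≡ 1 → n ≡ a * a + 1 → 0 < a →
    InDeltaStar n (a ∸ 1)
lemma4p11 _ (suc d) n-odd refl _ = SquarePlusOne.d∈Δ* d d-odd
  where
  d-odd : Odd d
  d-odd e d≡e+e = 0≢1+n (trans (sym ([1+2e]²+1-even e))
    (subst (λ m → (suc m * suc m + 1) % 2 ≡ 1) d≡e+e n-odd))
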